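{- Let $t>0$ and $i$ be integers with $0\le i<t$, and let $v\ge 2t+2-i$, $V=\{1,\ldots,v\}$. Let $T=\langle \{1\},\{2\},\ldots,\{i\},\{i+1\},\ldots,\{t+1\}\rangle$ and $T'=\langle \{1\},\ldots,\{i\},\{t+2\},\{t+3\},\ldots,\{2t+2-i\}\rangle$ (two $(t+1)$-subcubes of $2^V$). Then the symmetric difference $T\,\triangle\, T'$ is a $t$-unitrade of cardinality $2^{t+2}-2^{i+1}$, and it is splittable: there is a $[t]$-trade $\{T_0,T_1\}$ with $T_0\cup T_1=T\triangle T'$, of volume $2^{t+1}-2^{i}$.
   Context: Subsets of $V$ are identified with characteristic vectors, so $2^V=\mathbb F_2^v$, and $\langle\cdot\rangle$ denotes linear span over $\mathbb F_2$. For $n\in\{0,\ldots,v\}$, an $n$-subcube is a set $\{x\in 2^V : x_{l_j}=b_j,\ j=1,\ldots,v-n\}$ for distinct coordinates $l_j$ and constants $b_j\in\{0,1\}$. A $t$-unitrade is a subset of $2^V$ meeting every $(v-t)$-subcube in an even number of elements. A $[t]$-trade is a pair $\{T_0,T_1\}$ of disjoint subsets of $2^V$ such that for every $j\in\{0,\ldots,t\}$ and every $j$-element $s\subseteq V$, the number of elements of $T_0$ containing $s$ equals that of $T_1$; its volume is $|T_0|=|T_1|$. A $t$-unitrade $U$ is splittable if $U=T_0\cup T_1$ for some $[t]$-trade $\{T_0,T_1\}$. -}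

module Defs where

open import Data.Bool using (Bool; true; false; _∧_; _∨_; _xor_; not; if_then_else_)
open import Data.Nat using (ℕ; zero; suc; _+_; _≤_; _≡ᵇ_)
open import Data.Nat.Divisibility using (_∣_)
open import Data.Fin using (Fin; toℕ)
open import Data.Maybe using (Maybe; just; nothing)
open import Data.List using (List; []; _∷_; map; _++_; upTo; concatMap; foldr)
open import Data.Bool.ListAction using (any)
open import Data.Product using (_×_)
open import Data.Vec using (Vec; []; _∷_; tabulate; zipWith; replicate; toList)
open import Relation.Binary.PropositionalEquality using (_≡_)

-- Points of 2^V, V = {1,...,v} encoded as Fin v (coordinate k ↔ element k+1):
-- characteristic vectors in F_2^v.
Point : ℕ → Set
Point v = Vec Bool v

Family : ℕ → Set
Family v = Point v → Bool

allPoints : (v : ℕ) → List (Point v)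
allPoints zero    = [] ∷ []
allPoints (suc v) = concatMap (λ x → (false ∷ x) ∷ (true ∷ x) ∷ []) (allPoints v)

countB : {A : Set} → (A → Bool) → List A → ℕ
countB p []       = 0
countB p (x ∷ xs) = if p x then suc (countB p xs) else countB p xs

card : {v : ℕ} → Family v → ℕ
card {v} F = countB F (allPoints v)

eqB : Bool → Bool → Bool
eqB a b = not (a xor b)

_==_ : {v : ℕ} → Point v → Point v → Bool
[] == [] = true
(a ∷ x) == (b ∷ y) = eqB a b ∧ (x == y)

_⊕_ : {v : ℕ} → Point v → Point v → Point v
_⊕_ = zipWith _xor_

zeroPt : (v : ℕ) → Point v
zeroPt v = replicate v false

lincomb : {v : ℕ} → List Bool → List (Point v) → Point v
lincomb {v} (c ∷ cs) (g ∷ gs) = (if c then g else zeroPt v) ⊕ lincomb cs gs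
lincomb {v} _ _ = zeroPt v

allCoeffs : ℕ → List (List Bool)
allCoeffs zero    = [] ∷ []
allCoeffs (suc k) = concatMap (λ c → (false ∷ c) ∷ (true ∷ c) ∷ []) (allCoeffs k)

len : {A : Set} → List A → ℕ
len []       = 0
len (_ ∷ xs) = suc (len xs)

span : {v : ℕ} → List (Point v) → Family v
span gs x = any (λ c → lincomb c gs == x) (allCoeffs (len gs))

-- The singleton {k+1} ⊆ V (0-based coordinate k) as a characteristic vector.
singleton : (v : ℕ) → ℕ → Point v
singleton v k = tabulate (λ j → toℕ j ≡ᵇ k)

_△_ : {v : ℕ} → Family v → Family v → Family v
(F △ G) x = F x xor G x

-- Subcubes: a partial assignment fixing some coordinates.
-- The subcube of pattern f is {x | x_l = b whenever f_l = just b};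
-- its dimension n is v minus the number of fixed coordinates.
Pattern : ℕ → Set
Pattern v = Vec (Maybe Bool) v

numFixed : {v : ℕ} → Pattern v → ℕ
numFixed [] = 0
numFixed (just _  ∷ f) = suc (numFixed f)
numFixed (nothing ∷ f) = numFixed f

inCube : {v : ℕ} → Pattern v → Family v
inCube [] [] = true
inCube (just b  ∷ f) (a ∷ x) = eqB a b ∧ inCube f x
inCube (nothing ∷ f) (a ∷ x) = inCube f x

_∩_ : {v : ℕ} → Family v → Family v → Family v
(F ∩ G) x = F x ∧ G x

-- A (v−t)-subcube is one with exactly t fixed coordinates.
-- t-unitrade: meets every (v−t)-subcube in an even number of elements.
IsUnitrade : (v t : ℕ) → Family v → Set
IsUnitrade v t U = (f : Pattern v) → numFixed f ≡ t → 2 ∣ card (U ∩ inCube f)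

size : {v : ℕ} → Point v → ℕ
size [] = 0
size (true  ∷ s) = suc (size s)
size (false ∷ s) = size s

contains : {v : ℕ} → Point v → Point v → Bool
contains [] [] = true
contains (a ∷ x) (true  ∷ s) = a ∧ contains x s
contains (a ∷ x) (false ∷ s) = contains x s

containing : {v : ℕ} → Family v → Point v → Family v
containing F s x = F x ∧ contains x s

IsTrade : (v t : ℕ) → Family v → Family v → Set
IsTrade v t T0 T1 =
  ((x : Point v) → (T0 x ∧ T1 x) ≡ false) ×
  ((j : ℕ) → j ≤ t → (s : Point v) → size s ≡ j →
     card (containing T0 s) ≡ card (containing T1 s))

-- Call a family balanced if it has as many points of odd weight as of
-- even weight.  Two subcubes sharing a free coordinate meet in a balanced set
-- (flipping that coordinate exchanges the parities); this happens whenever one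
-- fixes fewer coordinates than the other leaves free.  As T and T′ have
-- dimension t + 1, both are balanced inside every subcube F fixing at most t
-- coordinates.  Then |(T △ T′) ∩ F| = |T ∩ F| + |T′ ∩ F| − 2|T ∩ T′ ∩ F| is
-- even, and the split T₀ = (even points of T∖T′) ∪ (odd points of T′∖T),
-- T₁ = (odd points of T∖T′) ∪ (even points of T′∖T) meets F equally often,
-- since both counts are a half of |T ∩ F| plus a half of |T′ ∩ F| minus |T ∩ T′ ∩ F|.

module Submission where

open import Defs
open import Data.Nat using (ℕ; _+_; _*_; _∸_; _^_; _≤_; _<_)
open import Data.Bool using (_∨_)
open import Data.List using (map; upTo; _++_)
open import Data.Product using (_×_; Σ)
open import Relation.Binary.PropositionalEquality using (_≡_)

open import Data.Bool using (Bool; true; false; _∧_; _xor_; not; if_then_else_; T)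
open import Data.Bool.Properties
  using (not-involutive; ∧-identityʳ; ∧-zeroʳ; ∧-comm; xor-same; xor-assoc; not-distribˡ-xor; not-distribʳ-xor; T-∧; T-∨)
open import Data.Empty using (⊥; ⊥-elim)
open import Data.Fin using (Fin; toℕ) renaming (zero to fzero; suc to fsuc)
open import Data.List using (List; []; _∷_; concatMap)
open import Data.Bool.ListAction using (any)
open import Data.List.Membership.Propositional using (_∈_)
open import Data.List.Membership.Propositional.Properties
  using (∈-upTo⁺; ∈-upTo⁻; ∈-++⁺ˡ; ∈-++⁺ʳ; ∈-++⁻; ∈-map⁺; ∈-map⁻)
open import Data.List.Membership.DecPropositional Data.Nat._≟_ using (_∈?_)
open import Data.List.Relation.Unary.Any as Any using (here; there; satisfied)
open import Data.List.Relation.Unary.Any.Properties using (any⁺; any⁻)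
open import Data.Maybe using (Maybe; just; nothing)
open import Data.Nat using (zero; suc; z≤n; s≤s; z<s; _≡ᵇ_; _<?_; _≤?_)
open import Data.Nat.Properties
open import Data.Nat.Tactic.RingSolver using (solve-∀)
open import Data.Nat.Divisibility using (_∣_; m∣m*n; ∣m∣n⇒∣m+n; ∣m+n∣m⇒∣n)
open import Algebra.Properties.CommutativeSemigroup +-commutativeSemigroup using (interchange)
open import Data.Product using (_,_; proj₁; proj₂)
open import Data.Sum using (_⊎_; inj₁; inj₂; [_,_]′)
open import Data.Unit using (tt)
open import Data.Vec using ([]; _∷_; replicate; tabulate; lookup)
open import Data.Vec.Properties using (lookup-zipWith; lookup-replicate; lookup∘tabulate)
open import Function.Bundles using (Equivalence; mk⇔)
open import Relation.Nullary using (Dec; yes; no; does; _×-dec_; _⊎-dec_)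
open import Relation.Nullary.Decidable using (dec-true; does-⇔)
open import Relation.Binary.PropositionalEquality
  using (refl; sym; trans; cong; cong₂; subst; subst₂; module ≡-Reasoning)
open ≡-Reasoning

ind : Bool → ℕ
ind true  = 1
ind false = 0

countB-∷ : {A : Set} (p : A → Bool) (x : A) (xs : List A) →
           countB p (x ∷ xs) ≡ ind (p x) + countB p xs
countB-∷ p x xs with p x
... | true  = refl
... | false = refl

countB-cong : {A : Set} {p q : A → Bool} → (∀ x → p x ≡ q x) →
              (xs : List A) → countB p xs ≡ countB q xs
countB-cong h [] = refl
countB-cong {p = p} {q} h (x ∷ xs) = begin
  countB p (x ∷ xs)        ≡⟨ countB-∷ p x xs ⟩
  ind (p x) + countB p xs  ≡⟨ cong₂ _+_ (cong ind (h x)) (countB-cong h xs) ⟩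
  ind (q x) + countB q xs  ≡⟨ countB-∷ q x xs ⟨
  countB q (x ∷ xs)        ∎

countB-never : {A : Set} (xs : List A) → countB (λ _ → false) xs ≡ 0
countB-never []       = refl
countB-never (x ∷ xs) = countB-never xs

guard : Bool → ℕ → ℕ
guard c n = if c then n else 0

countB-guard : {A : Set} (c : Bool) (p : A → Bool) (xs : List A) →
               countB (λ x → c ∧ p x) xs ≡ guard c (countB p xs)
countB-guard true  p xs = refl
countB-guard false p xs = countB-never xs

indAll : {A : Set} → List (A → Bool) → A → ℕ
indAll []       x = 0
indAll (p ∷ ps) x = ind (p x) + indAll ps x

countAll : {A : Set} → List (A → Bool) → List A → ℕ
countAll []       xs = 0
countAll (p ∷ ps) xs = countB p xs + countAll ps xs

countAll-[] : {A : Set} (ps : List (A → Bool)) → countAll ps [] ≡ 0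
countAll-[] []       = refl
countAll-[] (p ∷ ps) = countAll-[] ps

countAll-∷ : {A : Set} (ps : List (A → Bool)) (x : A) (xs : List A) →
             countAll ps (x ∷ xs) ≡ indAll ps x + countAll ps xs
countAll-∷ []       x xs = refl
countAll-∷ (p ∷ ps) x xs = begin
  countB p (x ∷ xs) + countAll ps (x ∷ xs)
    ≡⟨ cong₂ _+_ (countB-∷ p x xs) (countAll-∷ ps x xs) ⟩
  (ind (p x) + countB p xs) + (indAll ps x + countAll ps xs)
    ≡⟨ interchange (ind (p x)) _ _ _ ⟩
  (ind (p x) + indAll ps x) + (countB p xs + countAll ps xs) ∎

countAll-pointwise : {A : Set} (ps qs : List (A → Bool)) →
                     (∀ x → indAll ps x ≡ indAll qs x) →
                     (xs : List A) → countAll ps xs ≡ countAll qs xs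
countAll-pointwise ps qs h [] = trans (countAll-[] ps) (sym (countAll-[] qs))
countAll-pointwise ps qs h (x ∷ xs) = begin
  countAll ps (x ∷ xs)          ≡⟨ countAll-∷ ps x xs ⟩
  indAll ps x + countAll ps xs  ≡⟨ cong₂ _+_ (h x) (countAll-pointwise ps qs h xs) ⟩
  indAll qs x + countAll qs xs  ≡⟨ countAll-∷ qs x xs ⟨
  countAll qs (x ∷ xs)          ∎

countB-allPoints-suc : (v : ℕ) (F : Family (suc v)) →
  countB F (allPoints (suc v)) ≡
  countB (λ x → F (false ∷ x)) (allPoints v) + countB (λ x → F (true ∷ x)) (allPoints v)
countB-allPoints-suc v F = doubled (allPoints v)
  where
  F₀ F₁ : Family v
  F₀ x = F (false ∷ x)
  F₁ x = F (true ∷ x)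

  doubled : (xs : List (Point v)) →
    countB F (concatMap (λ x → (false ∷ x) ∷ (true ∷ x) ∷ []) xs) ≡ countB F₀ xs + countB F₁ xs
  doubled []       = refl
  doubled (x ∷ xs) = begin
    countB F ((false ∷ x) ∷ (true ∷ x) ∷ rest)
      ≡⟨ countB-∷ F (false ∷ x) ((true ∷ x) ∷ rest) ⟩
    ind (F₀ x) + countB F ((true ∷ x) ∷ rest)
      ≡⟨ cong (ind (F₀ x) +_) (countB-∷ F (true ∷ x) rest) ⟩
    ind (F₀ x) + (ind (F₁ x) + countB F rest)
      ≡⟨ cong (λ n → ind (F₀ x) + (ind (F₁ x) + n)) (doubled xs) ⟩
    ind (F₀ x) + (ind (F₁ x) + (countB F₀ xs + countB F₁ xs))
      ≡⟨ +-assoc (ind (F₀ x)) _ _ ⟨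
    (ind (F₀ x) + ind (F₁ x)) + (countB F₀ xs + countB F₁ xs)
      ≡⟨ interchange (ind (F₀ x)) _ _ _ ⟩
    (ind (F₀ x) + countB F₀ xs) + (ind (F₁ x) + countB F₁ xs)
      ≡⟨ cong₂ _+_ (countB-∷ F₀ x xs) (countB-∷ F₁ x xs) ⟨
    countB F₀ (x ∷ xs) + countB F₁ (x ∷ xs) ∎
    where rest = concatMap (λ x → (false ∷ x) ∷ (true ∷ x) ∷ []) xs

cubeHead : Maybe Bool → Bool → Bool
cubeHead nothing  a = true
cubeHead (just b) a = eqB a b

inCube-∷ : ∀ {v} (h : Maybe Bool) (g : Pattern v) (a : Bool) (x : Point v) →
           inCube (h ∷ g) (a ∷ x) ≡ cubeHead h a ∧ inCube g x
inCube-∷ nothing  g a x = refl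
inCube-∷ (just b) g a x = refl

dim : ∀ {v} → Pattern v → ℕ
dim []            = 0
dim (nothing ∷ g) = suc (dim g)
dim (just _  ∷ g) = dim g

card-cube : ∀ {v} (g : Pattern v) → card (inCube g) ≡ 2 ^ dim g
card-cube [] = refl
card-cube {suc v} (nothing ∷ g) = begin
  card (inCube (nothing ∷ g))                       ≡⟨ countB-allPoints-suc v _ ⟩
  card (inCube g) + card (inCube g)                 ≡⟨ cong₂ _+_ (card-cube g) (card-cube g) ⟩
  2 ^ dim g + 2 ^ dim g                             ≡⟨ cong (2 ^ dim g +_) (+-identityʳ _) ⟨
  2 ^ suc (dim g)                                   ∎
card-cube {suc v} (just false ∷ g) = begin
  card (inCube (just false ∷ g))                    ≡⟨ countB-allPoints-suc v _ ⟩
  card (inCube g) + countB (λ _ → false) (allPoints v)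
    ≡⟨ cong₂ _+_ (card-cube g) (countB-never (allPoints v)) ⟩
  2 ^ dim g + 0                                     ≡⟨ +-identityʳ _ ⟩
  2 ^ dim g                                         ∎
card-cube {suc v} (just true ∷ g) = begin
  card (inCube (just true ∷ g))                     ≡⟨ countB-allPoints-suc v _ ⟩
  countB (λ _ → false) (allPoints v) + card (inCube g)
    ≡⟨ cong (_+ card (inCube g)) (countB-never (allPoints v)) ⟩
  card (inCube g)                                   ≡⟨ card-cube g ⟩
  2 ^ dim g                                         ∎

fullCube : (v : ℕ) → Pattern v
fullCube v = replicate v nothing

inCube-fullCube : ∀ {v} (x : Point v) → inCube (fullCube v) x ≡ true
inCube-fullCube []      = refl
inCube-fullCube (a ∷ x) = inCube-fullCube x

numFixed-fullCube : (v : ℕ) → numFixed (fullCube v) ≡ 0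
numFixed-fullCube zero    = refl
numFixed-fullCube (suc v) = numFixed-fullCube v

supersetCube : ∀ {v} → Point v → Pattern v
supersetCube []          = []
supersetCube (true  ∷ s) = just true ∷ supersetCube s
supersetCube (false ∷ s) = nothing ∷ supersetCube s

eqB-true : (a : Bool) → eqB a true ≡ a
eqB-true true  = refl
eqB-true false = refl

inCube-supersetCube : ∀ {v} (s x : Point v) → inCube (supersetCube s) x ≡ contains x s
inCube-supersetCube []          []      = refl
inCube-supersetCube (true  ∷ s) (a ∷ x) = cong₂ _∧_ (eqB-true a) (inCube-supersetCube s x)
inCube-supersetCube (false ∷ s) (a ∷ x) = inCube-supersetCube s x

numFixed-supersetCube : ∀ {v} (s : Point v) → numFixed (supersetCube s) ≡ size s
numFixed-supersetCube []          = refl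
numFixed-supersetCube (true  ∷ s) = cong suc (numFixed-supersetCube s)
numFixed-supersetCube (false ∷ s) = numFixed-supersetCube s

-- Parity balance of intersections of subcubes.

par : ∀ {v} → Point v → Bool
par []      = false
par (a ∷ x) = a xor par x

-- Number of points of G whose parity differs from e: parityCount G true
-- counts the even points of G, parityCount G false the odd ones.
parityCount : ∀ {v} → Family v → Bool → ℕ
parityCount {v} G e = countB (λ x → G x ∧ (e xor par x)) (allPoints v)

Balanced : ∀ {v} → Family v → Set
Balanced G = parityCount G false ≡ parityCount G true

Balanced-cong : ∀ {v} {G H : Family v} → (∀ x → G x ≡ H x) → Balanced G → Balanced H
Balanced-cong {v} {G} {H} G≗H bal = begin
  parityCount H false  ≡⟨ countB-cong (λ x → cong (_∧ par x) (G≗H x)) (allPoints v) ⟨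
  parityCount G false  ≡⟨ bal ⟩
  parityCount G true   ≡⟨ countB-cong (λ x → cong (_∧ not (par x)) (G≗H x)) (allPoints v) ⟩
  parityCount H true   ∎

parity-split : ∀ {v} (G : Family v) → parityCount G false + parityCount G true ≡ card G
parity-split {v} G = begin
  parityCount G false + parityCount G true          ≡⟨ cong (parityCount G false +_) (+-identityʳ _) ⟨
  countAll (odd ∷ even ∷ []) (allPoints v)          ≡⟨ countAll-pointwise (odd ∷ even ∷ []) (G ∷ []) (λ x → split (G x) (par x)) (allPoints v) ⟩
  card G + 0                                        ≡⟨ +-identityʳ _ ⟩
  card G                                            ∎
  where
  odd even : Family v
  odd  x = G x ∧ par x
  even x = G x ∧ not (par x)
  split : (g p : Bool) → ind (g ∧ p) + (ind (g ∧ not p) + 0) ≡ ind g + 0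
  split true  true  = refl
  split true  false = refl
  split false p     = refl

balanced-card : ∀ {v} (G : Family v) → Balanced G → card G ≡ 2 * parityCount G true
balanced-card G bal = begin
  card G                                          ≡⟨ parity-split G ⟨
  parityCount G false + parityCount G true        ≡⟨ cong (_+ parityCount G true) bal ⟩
  parityCount G true + parityCount G true         ≡⟨ cong (parityCount G true +_) (+-identityʳ _) ⟨
  2 * parityCount G true                          ∎

sharedFree : ∀ {v} → Pattern v → Pattern v → Bool
sharedFree []      []      = false
sharedFree (nothing ∷ g) (nothing ∷ f) = true
sharedFree (nothing ∷ g) (just _  ∷ f) = sharedFree g f
sharedFree (just _  ∷ g) (k       ∷ f) = sharedFree g f

sharedFree-dim : ∀ {v} (g f : Pattern v) → numFixed f < dim g → sharedFree g f ≡ true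
sharedFree-dim (nothing ∷ g) (nothing ∷ f) lt       = refl
sharedFree-dim (nothing ∷ g) (just _  ∷ f) (s≤s lt) = sharedFree-dim g f lt
sharedFree-dim (just _  ∷ g) (nothing ∷ f) lt       = sharedFree-dim g f lt
sharedFree-dim (just _  ∷ g) (just _  ∷ f) lt       = sharedFree-dim g f (<-trans (n<1+n _) lt)

∧-regroup : (α β γ δ ε : Bool) → ((α ∧ β) ∧ (γ ∧ δ)) ∧ ε ≡ (α ∧ γ) ∧ ((β ∧ δ) ∧ ε)
∧-regroup false _     _     _ _ = refl
∧-regroup true  _     true  _ _ = refl
∧-regroup true  false false _ _ = refl
∧-regroup true  true  false _ _ = refl

-- Splitting the parity count of g ∩ f along the first coordinate: a first
-- coordinate 1 flips the parity of the remaining coordinates.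
parityCount-∷ : ∀ {v} (h k : Maybe Bool) (g f : Pattern v) (e : Bool) →
  parityCount (inCube (h ∷ g) ∩ inCube (k ∷ f)) e ≡
    guard (cubeHead h false ∧ cubeHead k false) (parityCount (inCube g ∩ inCube f) e)
  + guard (cubeHead h true ∧ cubeHead k true) (parityCount (inCube g ∩ inCube f) (not e))
parityCount-∷ {v} h k g f e =
  trans (countB-allPoints-suc v _) (cong₂ _+_ (on false e refl) (on true (not e) flip))
  where
  flip : ∀ {p} → e xor not p ≡ not e xor p
  flip {p} = trans (sym (not-distribʳ-xor e p)) (not-distribˡ-xor e p)
  on : (a e′ : Bool) → (∀ {p} → e xor (a xor p) ≡ e′ xor p) →
       countB (λ x → (inCube (h ∷ g) (a ∷ x) ∧ inCube (k ∷ f) (a ∷ x)) ∧ (e xor par (a ∷ x))) (allPoints v)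
       ≡ guard (cubeHead h a ∧ cubeHead k a) (parityCount (inCube g ∩ inCube f) e′)
  on a e′ shift = trans
    (countB-cong (λ x → trans
       (cong₂ (λ m n → (m ∧ n) ∧ (e xor par (a ∷ x))) (inCube-∷ h g a x) (inCube-∷ k f a x))
       (trans (∧-regroup (cubeHead h a) (inCube g x) (cubeHead k a) (inCube f x) _)
              (cong (λ z → (cubeHead h a ∧ cubeHead k a) ∧ ((inCube g x ∧ inCube f x) ∧ z)) shift)))
       (allPoints v))
    (countB-guard (cubeHead h a ∧ cubeHead k a) _ (allPoints v))

balance-tail : ∀ {v} (h k : Maybe Bool) (g f : Pattern v) →
  ((e : Bool) → parityCount (inCube g ∩ inCube f) e ≡ parityCount (inCube g ∩ inCube f) (not e)) →
  (e : Bool) → parityCount (inCube (h ∷ g) ∩ inCube (k ∷ f)) e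
             ≡ parityCount (inCube (h ∷ g) ∩ inCube (k ∷ f)) (not e)
balance-tail h k g f bal e = begin
  parityCount (inCube (h ∷ g) ∩ inCube (k ∷ f)) e
    ≡⟨ parityCount-∷ h k g f e ⟩
  guard c₀ (P e) + guard c₁ (P (not e))
    ≡⟨ cong₂ _+_ (cong (guard c₀) (bal e)) (cong (guard c₁) (bal (not e))) ⟩
  guard c₀ (P (not e)) + guard c₁ (P (not (not e)))
    ≡⟨ parityCount-∷ h k g f (not e) ⟨
  parityCount (inCube (h ∷ g) ∩ inCube (k ∷ f)) (not e) ∎
  where
  c₀ = cubeHead h false ∧ cubeHead k false
  c₁ = cubeHead h true ∧ cubeHead k true
  P  = parityCount (inCube g ∩ inCube f)

-- Key lemma: the intersection of two subcubes sharing a free coordinate is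
-- balanced (flipping that coordinate exchanges odd and even points).
balance : ∀ {v} (g f : Pattern v) → sharedFree g f ≡ true →
          (e : Bool) → parityCount (inCube g ∩ inCube f) e ≡ parityCount (inCube g ∩ inCube f) (not e)
balance []            []            () e
balance (nothing ∷ g) (nothing ∷ f) _ e = begin
  parityCount (inCube (nothing ∷ g) ∩ inCube (nothing ∷ f)) e
    ≡⟨ parityCount-∷ nothing nothing g f e ⟩
  P e + P (not e)              ≡⟨ +-comm (P e) _ ⟩
  P (not e) + P e              ≡⟨ cong (λ e′ → P (not e) + P e′) (not-involutive e) ⟨
  P (not e) + P (not (not e))  ≡⟨ parityCount-∷ nothing nothing g f (not e) ⟨
  parityCount (inCube (nothing ∷ g) ∩ inCube (nothing ∷ f)) (not e) ∎
  where P = parityCount (inCube g ∩ inCube f)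
balance (nothing ∷ g) (just b ∷ f) shared e = balance-tail nothing (just b) g f (balance g f shared) e
balance (just a  ∷ g) (k      ∷ f) shared e = balance-tail (just a) k g f (balance g f shared) e

cube-balanced : ∀ {v} (g f : Pattern v) → numFixed f < dim g → Balanced (inCube g ∩ inCube f)
cube-balanced g f lt = balance g f (sharedFree-dim g f lt) false

freeIf : Bool → Maybe Bool
freeIf b = if b then nothing else just false

coordCube : (v : ℕ) → (ℕ → Bool) → Pattern v
coordCube v P = tabulate (λ j → freeIf (P (toℕ j)))

cubeHead-freeIf : (b a : Bool) → cubeHead (freeIf b) a ≡ not a ∨ b
cubeHead-freeIf true  true  = refl
cubeHead-freeIf true  false = refl
cubeHead-freeIf false true  = refl
cubeHead-freeIf false false = refl

inCube-coordCube-∷ : (v : ℕ) (P : ℕ → Bool) (a : Bool) (x : Point v) →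
  inCube (coordCube (suc v) P) (a ∷ x) ≡ (not a ∨ P 0) ∧ inCube (coordCube v (λ k → P (suc k))) x
inCube-coordCube-∷ v P a x =
  trans (inCube-∷ (freeIf (P 0)) _ a x) (cong (_∧ _) (cubeHead-freeIf (P 0) a))

coordCube-∩ : (v : ℕ) (P Q : ℕ → Bool) (x : Point v) →
  inCube (coordCube v P) x ∧ inCube (coordCube v Q) x ≡ inCube (coordCube v (λ k → P k ∧ Q k)) x
coordCube-∩ zero    P Q []      = refl
coordCube-∩ (suc v) P Q (a ∷ x) = begin
  inCube (coordCube (suc v) P) (a ∷ x) ∧ inCube (coordCube (suc v) Q) (a ∷ x)
    ≡⟨ cong₂ _∧_ (inCube-coordCube-∷ v P a x) (inCube-coordCube-∷ v Q a x) ⟩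
  ((not a ∨ P 0) ∧ X) ∧ ((not a ∨ Q 0) ∧ Y)
    ≡⟨ regroup a (P 0) (Q 0) X Y ⟩
  (not a ∨ (P 0 ∧ Q 0)) ∧ (X ∧ Y)
    ≡⟨ cong ((not a ∨ (P 0 ∧ Q 0)) ∧_) (coordCube-∩ v (λ k → P (suc k)) (λ k → Q (suc k)) x) ⟩
  (not a ∨ (P 0 ∧ Q 0)) ∧ inCube (coordCube v (λ k → P (suc k) ∧ Q (suc k))) x
    ≡⟨ inCube-coordCube-∷ v (λ k → P k ∧ Q k) a x ⟨
  inCube (coordCube (suc v) (λ k → P k ∧ Q k)) (a ∷ x) ∎
  where
  X = inCube (coordCube v (λ k → P (suc k))) x
  Y = inCube (coordCube v (λ k → Q (suc k))) x
  regroup : (a p q X Y : Bool) → ((not a ∨ p) ∧ X) ∧ ((not a ∨ q) ∧ Y) ≡ (not a ∨ (p ∧ q)) ∧ (X ∧ Y)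
  regroup false p     q     X     Y = refl
  regroup true  false q     X     Y = refl
  regroup true  true  q     true  Y = refl
  regroup true  true  false false Y = refl
  regroup true  true  true  false Y = refl

countBelow : ℕ → (ℕ → Bool) → ℕ
countBelow zero    P = 0
countBelow (suc v) P = ind (P 0) + countBelow v (λ k → P (suc k))

dim-coordCube : (v : ℕ) (P : ℕ → Bool) → dim (coordCube v P) ≡ countBelow v P
dim-coordCube zero    P = refl
dim-coordCube (suc v) P = trans (dim-head (P 0)) (cong (ind (P 0) +_) (dim-coordCube v (λ k → P (suc k))))
  where
  dim-head : (b : Bool) → dim (freeIf b ∷ coordCube v (λ k → P (suc k))) ≡ ind b + dim (coordCube v (λ k → P (suc k)))
  dim-head true  = refl
  dim-head false = refl

T-not-both : (c : Bool) → T (not c) → T c → ⊥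
T-not-both true  () _
T-not-both false _  ()

T-ext : {a b : Bool} → (T a → T b) → (T b → T a) → a ≡ b
T-ext {true}  {true}  _ _ = refl
T-ext {true}  {false} f _ = ⊥-elim (f tt)
T-ext {false} {true}  _ g = ⊥-elim (g tt)
T-ext {false} {false} _ _ = refl

Supported : ∀ {v} → (ℕ → Bool) → Point v → Set
Supported P x = ∀ j → T (lookup x j) → T (P (toℕ j))

coordCube→supported : ∀ {v} (P : ℕ → Bool) (x : Point v) →
                      T (inCube (coordCube v P) x) → Supported P x
coordCube→supported {suc v} P (a ∷ x) x∈ j xⱼ
  with Equivalence.to (T-∧ {not a ∨ P 0}) (subst T (inCube-coordCube-∷ v P a x) x∈)
coordCube→supported P (true ∷ x) x∈ fzero    xⱼ | P₀ , _     = P₀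
coordCube→supported P (a ∷ x)    x∈ (fsuc j) xⱼ | _  , x′∈ = coordCube→supported (λ k → P (suc k)) x x′∈ j xⱼ

supported→coordCube : ∀ {v} (P : ℕ → Bool) (x : Point v) →
                      Supported P x → T (inCube (coordCube v P) x)
supported→coordCube P []      sx = tt
supported→coordCube {suc v} P (a ∷ x) sx = subst T (sym (inCube-coordCube-∷ v P a x))
  (Equivalence.from (T-∧ {not a ∨ P 0}) (head a (sx fzero) , supported→coordCube (λ k → P (suc k)) x (λ j → sx (fsuc j))))
  where
  head : (a : Bool) → (T a → T (P 0)) → T (not a ∨ P 0)
  head true  f = f tt
  head false f = tt

supported-zero : ∀ {v} (P : ℕ → Bool) → Supported P (zeroPt v)
supported-zero P j h = ⊥-elim (subst T (lookup-replicate j false) h)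

supported-⊕ : ∀ {v} (P : ℕ → Bool) (y z : Point v) →
              Supported P y → Supported P z → Supported P (y ⊕ z)
supported-⊕ P y z sy sz j h =
  [ sy j , sz j ]′ (xor-true (lookup y j) _ (subst T (lookup-zipWith _xor_ j y z) h))
  where
  xor-true : (a b : Bool) → T (a xor b) → T a ⊎ T b
  xor-true true  b _ = inj₁ tt
  xor-true false b h = inj₂ h

supported-singleton : ∀ {v} (P : ℕ → Bool) (l : ℕ) → T (P l) → Supported P (singleton v l)
supported-singleton P l Pl j h =
  subst (λ k → T (P k)) (sym (≡ᵇ⇒≡ (toℕ j) l (subst T (lookup∘tabulate _ j) h))) Pl

supported-lincomb : ∀ {v} (P : ℕ → Bool) (c : List Bool) (L : List ℕ) →
  (∀ {l} → l ∈ L → T (P l)) → Supported P (lincomb c (map (singleton v) L))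
supported-lincomb P []      L       PL = supported-zero P
supported-lincomb P (b ∷ c) []      PL = supported-zero P
supported-lincomb {v} P (b ∷ c) (l ∷ L) PL =
  supported-⊕ P (if b then singleton v l else zeroPt v) (lincomb c (map (singleton v) L))
    (scaled b) (supported-lincomb P c L (λ l∈L → PL (there l∈L)))
  where
  scaled : (b : Bool) → Supported P (if b then singleton v l else zeroPt v)
  scaled true  = supported-singleton P l (PL (here refl))
  scaled false = supported-zero P

memb : List ℕ → ℕ → Bool
memb L k = any (λ l → k ≡ᵇ l) L

memb-does : (L : List ℕ) (k : ℕ) → memb L k ≡ does (k ∈? L)
memb-does []      k = refl
memb-does (l ∷ L) k = cong ((k ≡ᵇ l) ∨_) (memb-does L k)

memb-intro : {L : List ℕ} {k : ℕ} → k ∈ L → T (memb L k)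
memb-intro {L} {k} k∈L = subst T (sym (trans (memb-does L k) (dec-true (k ∈? L) k∈L))) tt

-- Coordinate l of a point (0 beyond the dimension).
bitAt : ∀ {v} → Point v → ℕ → Bool
bitAt []      k       = false
bitAt (a ∷ x) zero    = a
bitAt (a ∷ x) (suc k) = bitAt x k

bitAt-lookup : ∀ {v} (x : Point v) (j : Fin v) → bitAt x (toℕ j) ≡ lookup x j
bitAt-lookup (a ∷ x) fzero    = refl
bitAt-lookup (a ∷ x) (fsuc j) = bitAt-lookup x j

component : ∀ {v} → Point v → ℕ → Point v
component {v} x l = if bitAt x l then singleton v l else zeroPt v

lookup-scaled : ∀ {v} (b : Bool) (l : ℕ) (j : Fin v) →
  lookup (if b then singleton v l else zeroPt v) j ≡ b ∧ (toℕ j ≡ᵇ l)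
lookup-scaled true  l j = lookup∘tabulate _ j
lookup-scaled false l j = lookup-replicate j false

lookup-clear : ∀ {v} (x : Point v) (l : ℕ) (j : Fin v) →
  lookup (component x l ⊕ x) j ≡ not (toℕ j ≡ᵇ l) ∧ lookup x j
lookup-clear x l j = begin
  lookup (component x l ⊕ x) j                       ≡⟨ lookup-zipWith _xor_ j (component x l) x ⟩
  lookup (component x l) j xor lookup x j            ≡⟨ cong (_xor lookup x j) (lookup-scaled (bitAt x l) l j) ⟩
  (bitAt x l ∧ (toℕ j ≡ᵇ l)) xor lookup x j          ≡⟨ mask (bitAt x l) (toℕ j ≡ᵇ l) (lookup x j) same ⟩
  not (toℕ j ≡ᵇ l) ∧ lookup x j                      ∎
  where
  same : T (toℕ j ≡ᵇ l) → bitAt x l ≡ lookup x j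
  same j≡l = trans (cong (bitAt x) (sym (≡ᵇ⇒≡ (toℕ j) l j≡l))) (bitAt-lookup x j)
  mask : (b c y : Bool) → (T c → b ≡ y) → (b ∧ c) xor y ≡ not c ∧ y
  mask b false y _  = cong (_xor y) (∧-zeroʳ b)
  mask b true  y eq = trans (cong (_xor y) (trans (∧-identityʳ b) (eq tt))) (xor-same y)

⊕-cancel : ∀ {v} (e x : Point v) → e ⊕ (e ⊕ x) ≡ x
⊕-cancel []      []      = refl
⊕-cancel (a ∷ e) (b ∷ x) =
  cong₂ _∷_ (trans (sym (xor-assoc a a b)) (cong (_xor b) (xor-same a))) (⊕-cancel e x)

clear-supported : ∀ {v} (l : ℕ) (L : List ℕ) (x : Point v) →
  Supported (memb (l ∷ L)) x → Supported (memb L) (component x l ⊕ x)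
clear-supported l L x sx j h = keep (Equivalence.to (T-∨ {toℕ j ≡ᵇ l}) (sx j (proj₂ cleared)))
  where
  cleared : T (not (toℕ j ≡ᵇ l)) × T (lookup x j)
  cleared = Equivalence.to (T-∧ {not (toℕ j ≡ᵇ l)}) (subst T (lookup-clear x l j) h)
  keep : T (toℕ j ≡ᵇ l) ⊎ T (memb L (toℕ j)) → T (memb L (toℕ j))
  keep (inj₁ j≡l) = ⊥-elim (T-not-both (toℕ j ≡ᵇ l) (proj₁ cleared) j≡l)
  keep (inj₂ j∈L) = j∈L

supported→lincomb : ∀ {v} (L : List ℕ) (x : Point v) → Supported (memb L) x →
  Σ (List Bool) λ c → len c ≡ len (map (singleton v) L) × lincomb c (map (singleton v) L) ≡ x
supported→lincomb []      x sx = [] , refl , unsupported x sx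
  where
  unsupported : ∀ {v} (x : Point v) → Supported (λ _ → false) x → zeroPt v ≡ x
  unsupported []          sx = refl
  unsupported (false ∷ x) sx = cong (false ∷_) (unsupported x (λ j → sx (fsuc j)))
  unsupported (true  ∷ x) sx = ⊥-elim (sx fzero tt)
supported→lincomb (l ∷ L) x sx
  with supported→lincomb L (component x l ⊕ x) (clear-supported l L x sx)
... | c , len-c , comb =
  bitAt x l ∷ c , cong suc len-c ,
  trans (cong (component x l ⊕_) comb) (⊕-cancel (component x l) x)

span→lincomb : ∀ {v} (gs : List (Point v)) (x : Point v) →
  T (span gs x) → Σ (List Bool) λ c → lincomb c gs ≡ x
span→lincomb gs x x∈ with satisfied (any⁻ _ (allCoeffs (len gs)) x∈)
... | c , comb = c , ==-sound (lincomb c gs) x comb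
  where
  ==-sound : ∀ {v} (y z : Point v) → T (y == z) → y ≡ z
  ==-sound []      []      _ = refl
  ==-sound (true  ∷ y) (true  ∷ z) h = cong (true ∷_)  (==-sound y z h)
  ==-sound (false ∷ y) (false ∷ z) h = cong (false ∷_) (==-sound y z h)

lincomb→span : ∀ {v} (gs : List (Point v)) (x : Point v) (c : List Bool) →
  len c ≡ len gs → lincomb c gs ≡ x → T (span gs x)
lincomb→span gs x c len-c refl =
  any⁺ _ (Any.map (λ { refl → ==-refl (lincomb c gs) })
                  (subst (λ n → c ∈ allCoeffs n) len-c (allCoeffs-complete c)))
  where
  ==-refl : ∀ {v} (y : Point v) → T (y == y)
  ==-refl []          = tt
  ==-refl (true  ∷ y) = ==-refl y
  ==-refl (false ∷ y) = ==-refl y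
  doubled : ∀ {c : List Bool} (b : Bool) (cs : List (List Bool)) → c ∈ cs →
            (b ∷ c) ∈ concatMap (λ c → (false ∷ c) ∷ (true ∷ c) ∷ []) cs
  doubled false (c ∷ cs) (here refl) = here refl
  doubled true  (c ∷ cs) (here refl) = there (here refl)
  doubled b     (c ∷ cs) (there c∈) = there (there (doubled b cs c∈))
  allCoeffs-complete : (c : List Bool) → c ∈ allCoeffs (len c)
  allCoeffs-complete []      = here refl
  allCoeffs-complete (b ∷ c) = doubled b (allCoeffs (len c)) (allCoeffs-complete c)

span-coordCube : (v : ℕ) (L : List ℕ) (x : Point v) →
  span (map (singleton v) L) x ≡ inCube (coordCube v (memb L)) x
span-coordCube v L x = T-ext to from
  where
  to : T (span (map (singleton v) L) x) → T (inCube (coordCube v (memb L)) x)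
  to x∈ with span→lincomb (map (singleton v) L) x x∈
  ... | c , refl = supported→coordCube (memb L) (lincomb c (map (singleton v) L))
                     (supported-lincomb {v} (memb L) c L (λ {l} → memb-intro {L} {l}))
  from : T (inCube (coordCube v (memb L)) x) → T (span (map (singleton v) L) x)
  from x∈ with supported→lincomb L x (coordCube→supported (memb L) x x∈)
  ... | c , len-c , comb = lincomb→span (map (singleton v) L) x c len-c comb

countBelow-cong : (v : ℕ) {P Q : ℕ → Bool} → (∀ k → P k ≡ Q k) → countBelow v P ≡ countBelow v Q
countBelow-cong zero    P≗Q = refl
countBelow-cong (suc v) P≗Q = cong₂ _+_ (cong ind (P≗Q 0)) (countBelow-cong v (λ k → P≗Q (suc k)))

countBelow-linear : (v : ℕ) (P Q R S : ℕ → Bool) →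
  (∀ k → ind (P k) + ind (Q k) ≡ ind (R k) + ind (S k)) →
  countBelow v P + countBelow v Q ≡ countBelow v R + countBelow v S
countBelow-linear zero    P Q R S h = refl
countBelow-linear (suc v) P Q R S h = begin
  (ind (P 0) + countBelow v P′) + (ind (Q 0) + countBelow v Q′)
    ≡⟨ interchange (ind (P 0)) _ _ _ ⟩
  (ind (P 0) + ind (Q 0)) + (countBelow v P′ + countBelow v Q′)
    ≡⟨ cong₂ _+_ (h 0) (countBelow-linear v P′ Q′ R′ S′ (λ k → h (suc k))) ⟩
  (ind (R 0) + ind (S 0)) + (countBelow v R′ + countBelow v S′)
    ≡⟨ interchange (ind (R 0)) _ _ _ ⟩
  (ind (R 0) + countBelow v R′) + (ind (S 0) + countBelow v S′) ∎
  where
  P′ Q′ R′ S′ : ℕ → Bool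
  P′ k = P (suc k)
  Q′ k = Q (suc k)
  R′ k = R (suc k)
  S′ k = S (suc k)

below : ℕ → ℕ → Bool
below n k = does (k <? n)

countBelow-below : (v n : ℕ) → n ≤ v → countBelow v (below n) ≡ n
countBelow-below zero    zero    _         = refl
countBelow-below (suc v) zero    _         = none v
  where
  none : (v : ℕ) → countBelow v (λ _ → false) ≡ 0
  none zero    = refl
  none (suc v) = none v
countBelow-below (suc v) (suc n) (s≤s n≤v) = cong suc (countBelow-below v n n≤v)

window : ℕ → ℕ → ℕ → ℕ → Bool
window a b m k = does (k <? a ⊎-dec (b ≤? k ×-dec k <? b + m))

memb-upTo : (n k : ℕ) → memb (upTo n) k ≡ below n k
memb-upTo n k = trans (memb-does (upTo n) k) (does-⇔ (mk⇔ ∈-upTo⁻ ∈-upTo⁺) (k ∈? upTo n) (k <? n))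

memb-window : (a b m k : ℕ) → memb (upTo a ++ map (λ k → b + k) (upTo m)) k ≡ window a b m k
memb-window a b m k = trans (memb-does (upTo a ++ map (λ k → b + k) (upTo m)) k) (does-⇔ (mk⇔ to from) (k ∈? _) (k <? a ⊎-dec (b ≤? k ×-dec k <? b + m)))
  where
  to : k ∈ upTo a ++ map (λ k → b + k) (upTo m) → k < a ⊎ (b ≤ k × k < b + m)
  to k∈ with ∈-++⁻ (upTo a) k∈
  ... | inj₁ k∈a = inj₁ (∈-upTo⁻ k∈a)
  ... | inj₂ k∈w with ∈-map⁻ (λ k → b + k) k∈w
  ...   | y , y<m , k≡b+y =
    inj₂ (subst (λ k → b ≤ k × k < b + m) (sym k≡b+y) (m≤m+n b y , +-monoʳ-< b (∈-upTo⁻ y<m)))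
  from : k < a ⊎ (b ≤ k × k < b + m) → k ∈ upTo a ++ map (λ k → b + k) (upTo m)
  from (inj₁ k<a)           = ∈-++⁺ˡ (∈-upTo⁺ k<a)
  from (inj₂ (b≤k , k<b+m)) = ∈-++⁺ʳ (upTo a)
    (subst (_∈ map (λ k → b + k) (upTo m)) (m+[n∸m]≡n b≤k)
      (∈-map⁺ (λ k → b + k) (∈-upTo⁺ (+-cancelˡ-< b _ _ (subst (_< b + m) (sym (m+[n∸m]≡n b≤k)) k<b+m)))))

window-cover : (a b m k : ℕ) → a ≤ b →
  ind (window a b m k) + ind (below b k) ≡ ind (below a k) + ind (below (b + m) k)
window-cover a b m k a≤b = cover (k <? a) (b ≤? k) (k <? b) (k <? b + m)
  where
  cover : (k<a? : Dec (k < a)) (b≤k? : Dec (b ≤ k)) (k<b? : Dec (k < b)) (k<b+m? : Dec (k < b + m)) →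
    ind (does (k<a? ⊎-dec (b≤k? ×-dec k<b+m?))) + ind (does k<b?) ≡ ind (does k<a?) + ind (does k<b+m?)
  cover (yes _)   _         (yes _)   (yes _)    = refl
  cover (yes k<a) _         (no k≮b)  _          = ⊥-elim (k≮b (<-≤-trans k<a a≤b))
  cover (yes k<a) _         (yes _)   (no k≮b+m) = ⊥-elim (k≮b+m (<-≤-trans k<a (≤-trans a≤b (m≤m+n b m))))
  cover (no _)    (yes b≤k) (yes k<b) _          = ⊥-elim (<⇒≱ k<b b≤k)
  cover (no _)    (yes _)   (no _)    (yes _)    = refl
  cover (no _)    (yes _)   (no _)    (no _)     = refl
  cover (no _)    (no _)    (yes _)   (yes _)    = refl
  cover (no _)    (no _)    (yes k<b) (no k≮b+m) = ⊥-elim (k≮b+m (<-≤-trans k<b (m≤m+n b m)))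
  cover (no _)    (no b≰k)  (no k≮b)  _          = ⊥-elim (k≮b (≰⇒> b≰k))

window-∩-below : (a b m k : ℕ) → a ≤ b → (below b k ∧ window a b m k) ≡ below a k
window-∩-below a b m k a≤b = meet (k <? b) (k <? a) (b ≤? k)
  where
  meet : (k<b? : Dec (k < b)) (k<a? : Dec (k < a)) (b≤k? : Dec (b ≤ k)) →
    (does k<b? ∧ does (k<a? ⊎-dec (b≤k? ×-dec (k <? b + m)))) ≡ does k<a?
  meet (yes _)   (yes _)   _         = refl
  meet (yes k<b) (no _)    (yes b≤k) = ⊥-elim (<⇒≱ k<b b≤k)
  meet (yes _)   (no _)    (no _)    = refl
  meet (no k≮b)  (yes k<a) _         = ⊥-elim (k≮b (<-≤-trans k<a a≤b))
  meet (no _)    (no _)    _         = refl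

countBelow-window : (v a b m : ℕ) → a ≤ b → b + m ≤ v → countBelow v (window a b m) ≡ a + m
countBelow-window v a b m a≤b b+m≤v = +-cancelʳ-≡ b _ _ (begin
  countBelow v (window a b m) + b
    ≡⟨ cong (countBelow v (window a b m) +_) (countBelow-below v b b≤v) ⟨
  countBelow v (window a b m) + countBelow v (below b)
    ≡⟨ countBelow-linear v _ _ _ _ (λ k → window-cover a b m k a≤b) ⟩
  countBelow v (below a) + countBelow v (below (b + m))
    ≡⟨ cong₂ _+_ (countBelow-below v a (≤-trans a≤b b≤v)) (countBelow-below v (b + m) b+m≤v) ⟩
  a + (b + m)
    ≡⟨ cong (a +_) (+-comm b m) ⟩
  a + (m + b)
    ≡⟨ +-assoc a m b ⟨
  a + m + b ∎)
  where
  b≤v : b ≤ v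
  b≤v = ≤-trans (m≤m+n b m) b+m≤v

parityPart : ∀ {v} → Family v → Family v → Family v
parityPart T T′ x = (T x ∧ not (T′ x) ∧ not (par x)) ∨ (T′ x ∧ not (T x) ∧ par x)

parityPart-disjoint : ∀ {v} (T T′ : Family v) (x : Point v) →
                      (parityPart T T′ x ∧ parityPart T′ T x) ≡ false
parityPart-disjoint T T′ x = disjoint (T x) (T′ x) (par x)
  where
  disjoint : (a b p : Bool) →
    (((a ∧ not b ∧ not p) ∨ (b ∧ not a ∧ p)) ∧ ((b ∧ not a ∧ not p) ∨ (a ∧ not b ∧ p))) ≡ false
  disjoint true  true  p     = refl
  disjoint true  false true  = refl
  disjoint true  false false = refl
  disjoint false true  true  = refl
  disjoint false true  false = refl
  disjoint false false p     = refl

parityPart-union : ∀ {v} (T T′ : Family v) (x : Point v) →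
                   (parityPart T T′ x ∨ parityPart T′ T x) ≡ (T △ T′) x
parityPart-union T T′ x = union (T x) (T′ x) (par x)
  where
  union : (a b p : Bool) →
    (((a ∧ not b ∧ not p) ∨ (b ∧ not a ∧ p)) ∨ ((b ∧ not a ∧ not p) ∨ (a ∧ not b ∧ p))) ≡ (a xor b)
  union true  true  p     = refl
  union true  false true  = refl
  union true  false false = refl
  union false true  true  = refl
  union false true  false = refl
  union false false p     = refl

parityPart-count : ∀ {v} (T T′ F : Family v) →
  card (parityPart T T′ ∩ F) + (parityCount ((T ∩ T′) ∩ F) false + parityCount ((T ∩ T′) ∩ F) true)
  ≡ parityCount (T ∩ F) true + parityCount (T′ ∩ F) false
parityPart-count {v} T T′ F = begin
  card (parityPart T T′ ∩ F) + (odd (T ∩ T′) + even (T ∩ T′))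
    ≡⟨ cong (λ n → card (parityPart T T′ ∩ F) + (odd (T ∩ T′) + n)) (+-identityʳ _) ⟨
  countAll ((parityPart T T′ ∩ F) ∷ odd-in (T ∩ T′) ∷ even-in (T ∩ T′) ∷ []) (allPoints v)
    ≡⟨ countAll-pointwise ((parityPart T T′ ∩ F) ∷ odd-in (T ∩ T′) ∷ even-in (T ∩ T′) ∷ []) (even-in T ∷ odd-in T′ ∷ [])
         (λ x → table (T x) (T′ x) (F x) (par x)) (allPoints v) ⟩
  even T + (odd T′ + 0)
    ≡⟨ cong (even T +_) (+-identityʳ _) ⟩
  even T + odd T′ ∎
  where
  odd-in even-in : Family v → Family v
  odd-in  G x = (G ∩ F) x ∧ par x
  even-in G x = (G ∩ F) x ∧ not (par x)
  odd even : Family v → ℕ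
  odd  G = parityCount (G ∩ F) false
  even G = parityCount (G ∩ F) true
  table : (a b c p : Bool) →
      ind ((((a ∧ not b ∧ not p) ∨ (b ∧ not a ∧ p))) ∧ c)
    + (ind (((a ∧ b) ∧ c) ∧ p) + (ind (((a ∧ b) ∧ c) ∧ not p) + 0))
    ≡ ind ((a ∧ c) ∧ not p) + (ind ((b ∧ c) ∧ p) + 0)
  table true  true  true  true  = refl
  table true  true  true  false = refl
  table true  true  false p     = refl
  table true  false true  true  = refl
  table true  false true  false = refl
  table true  false false true  = refl
  table true  false false false = refl
  table false true  true  true  = refl
  table false true  true  false = refl
  table false true  false true  = refl
  table false true  false false = refl
  table false false c     true  = refl
  table false false true  false = refl
  table false false false false = refl

parityParts-balanced : ∀ {v} (T T′ F : Family v) →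
  Balanced (T ∩ F) → Balanced (T′ ∩ F) →
  card (parityPart T T′ ∩ F) ≡ card (parityPart T′ T ∩ F)
parityParts-balanced {v} T T′ F balT balT′ = +-cancelʳ-≡ common _ _ (begin
  card (parityPart T T′ ∩ F) + common   ≡⟨ parityPart-count T T′ F ⟩
  even T + odd T′                       ≡⟨ cong₂ _+_ (sym balT) balT′ ⟩
  odd T + even T′                       ≡⟨ +-comm (odd T) _ ⟩
  even T′ + odd T                       ≡⟨ parityPart-count T′ T F ⟨
  card (parityPart T′ T ∩ F) + common′  ≡⟨ cong (card (parityPart T′ T ∩ F) +_) common-sym ⟩
  card (parityPart T′ T ∩ F) + common   ∎)
  where
  odd even : Family v → ℕ
  odd  G = parityCount (G ∩ F) false
  even G = parityCount (G ∩ F) true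
  common common′ : ℕ
  common  = odd (T ∩ T′) + even (T ∩ T′)
  common′ = odd (T′ ∩ T) + even (T′ ∩ T)
  swap : (e : Bool) → parityCount ((T′ ∩ T) ∩ F) e ≡ parityCount ((T ∩ T′) ∩ F) e
  swap e = countB-cong (λ x → cong (λ z → (z ∧ F x) ∧ (e xor par x)) (∧-comm (T′ x) (T x))) (allPoints v)
  common-sym : common′ ≡ common
  common-sym = cong₂ _+_ (swap false) (swap true)

symDiff-count : ∀ {v} (T T′ F : Family v) →
  card ((T △ T′) ∩ F) + (card ((T ∩ T′) ∩ F) + card ((T ∩ T′) ∩ F)) ≡ card (T ∩ F) + card (T′ ∩ F)
symDiff-count {v} T T′ F = begin
  card ((T △ T′) ∩ F) + (card ((T ∩ T′) ∩ F) + card ((T ∩ T′) ∩ F))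
    ≡⟨ cong (λ n → card ((T △ T′) ∩ F) + (card ((T ∩ T′) ∩ F) + n)) (+-identityʳ _) ⟨
  countAll (((T △ T′) ∩ F) ∷ ((T ∩ T′) ∩ F) ∷ ((T ∩ T′) ∩ F) ∷ []) (allPoints v)
    ≡⟨ countAll-pointwise (((T △ T′) ∩ F) ∷ ((T ∩ T′) ∩ F) ∷ ((T ∩ T′) ∩ F) ∷ []) ((T ∩ F) ∷ (T′ ∩ F) ∷ []) (λ x → table (T x) (T′ x) (F x)) (allPoints v) ⟩
  card (T ∩ F) + (card (T′ ∩ F) + 0)
    ≡⟨ cong (card (T ∩ F) +_) (+-identityʳ _) ⟩
  card (T ∩ F) + card (T′ ∩ F) ∎
  where
  table : (a b c : Bool) →
    ind ((a xor b) ∧ c) + (ind ((a ∧ b) ∧ c) + (ind ((a ∧ b) ∧ c) + 0)) ≡ ind (a ∧ c) + (ind (b ∧ c) + 0)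
  table true  true  true  = refl
  table true  true  false = refl
  table true  false c     = refl
  table false true  c     = refl
  table false false c     = refl

symDiff-even : ∀ {v} (T T′ F : Family v) →
  Balanced (T ∩ F) → Balanced (T′ ∩ F) → 2 ∣ card ((T △ T′) ∩ F)
symDiff-even T T′ F balT balT′ =
  ∣m+n∣m⇒∣n (subst (2 ∣_) (trans (sym (symDiff-count T T′ F)) (+-comm (card ((T △ T′) ∩ F)) _)) sum-even)
            (subst (2 ∣_) (cong (A +_) (+-identityʳ A)) (m∣m*n A))
  where
  A = card ((T ∩ T′) ∩ F)
  sum-even : 2 ∣ card (T ∩ F) + card (T′ ∩ F)
  sum-even = ∣m∣n⇒∣m+n (subst (2 ∣_) (sym (balanced-card (T ∩ F) balT)) (m∣m*n (parityCount (T ∩ F) true)))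
                       (subst (2 ∣_) (sym (balanced-card (T′ ∩ F) balT′)) (m∣m*n (parityCount (T′ ∩ F) true)))

pow-double : (n : ℕ) → 2 ^ (n + 1) ≡ 2 ^ n + 2 ^ n
pow-double n = trans (cong (2 ^_) (+-comm n 1)) (cong (2 ^ n +_) (+-identityʳ _))

∸-from-+ : {m n k : ℕ} → m + n ≡ k → m ≡ k ∸ n
∸-from-+ {m} {n} eq = trans (sym (m+n∸n≡m m n)) (cong (_∸ n) eq)

doubling : ∀ n → 2 * n + 2 ≡ (n + 1) + (n + 1)
doubling = solve-∀

whole : (v : ℕ) → Family v
whole v _ = true

card-∩-whole : ∀ {v} (G : Family v) → card (G ∩ whole v) ≡ card G
card-∩-whole {v} G = countB-cong (λ x → ∧-identityʳ (G x)) (allPoints v)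

card-containing : ∀ {v} (G : Family v) (s : Point v) →
                  card (containing G s) ≡ card (G ∩ inCube (supersetCube s))
card-containing {v} G s = countB-cong (λ x → cong (G x ∧_) (sym (inCube-supersetCube s x))) (allPoints v)

subcube-balanced : ∀ {v} (G : Family v) (g : Pattern v) → (∀ x → G x ≡ inCube g x) →
                   (f : Pattern v) → numFixed f < dim g → Balanced (G ∩ inCube f)
subcube-balanced G g G≗g f lt =
  Balanced-cong (λ x → cong (_∧ inCube f x) (sym (G≗g x))) (cube-balanced g f lt)

subcube-even : ∀ {v} (G : Family v) (g : Pattern v) → (∀ x → G x ≡ inCube g x) →
               (n : ℕ) → dim g ≡ n + 1 → parityCount (G ∩ whole v) true ≡ 2 ^ n
subcube-even {v} G g G≗g n dim-g = *-cancelˡ-≡ _ _ 2 (begin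
  2 * parityCount (G ∩ whole v) true  ≡⟨ balanced-card (G ∩ whole v) balanced ⟨
  card (G ∩ whole v)                  ≡⟨ card-∩-whole G ⟩
  card G                              ≡⟨ countB-cong G≗g (allPoints v) ⟩
  card (inCube g)                     ≡⟨ card-cube g ⟩
  2 ^ dim g                           ≡⟨ cong (2 ^_) dim-g ⟩
  2 ^ (n + 1)                         ≡⟨ pow-double n ⟩
  2 ^ n + 2 ^ n                       ≡⟨ cong (2 ^ n +_) (+-identityʳ _) ⟨
  2 * 2 ^ n                           ∎)
  where
  fixes-nothing : numFixed (fullCube v) < dim g
  fixes-nothing = subst₂ _<_ (sym (numFixed-fullCube v)) (sym dim-g) (subst (0 <_) (+-comm 1 n) z<s)
  balanced : Balanced (G ∩ whole v)
  balanced = Balanced-cong (λ x → cong (G x ∧_) (inCube-fullCube x))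
                           (subcube-balanced G g G≗g (fullCube v) fixes-nothing)

module TwoCubes (t i v : ℕ) (i<t : i < t) (v-large : 2 * t + 2 ∸ i ≤ v) where

  -- The cubes T = C and T′ = C′ of the statement: C is spanned by the
  -- coordinates [0, t+1), C′ by [0, i) ∪ [t+1, 2t+2-i).
  m : ℕ
  m = t + 1 ∸ i

  LT LT′ : List ℕ
  LT  = upTo (t + 1)
  LT′ = upTo i ++ map (λ k → t + 1 + k) (upTo m)

  C C′ : Family v
  C  = span (map (singleton v) LT)
  C′ = span (map (singleton v) LT′)

  i≤t+1 : i ≤ t + 1
  i≤t+1 = ≤-trans (<⇒≤ i<t) (m≤m+n t 1)

  window≤v : t + 1 + m ≤ v
  window≤v = subst (_≤ v) (trans (cong (_∸ i) double) (+-∸-assoc (t + 1) i≤t+1)) v-large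
    where
    double : 2 * t + 2 ≡ (t + 1) + (t + 1)
    double = doubling t

  t+1≤v : t + 1 ≤ v
  t+1≤v = ≤-trans (m≤m+n (t + 1) m) window≤v

  cube-C : ∀ x → C x ≡ inCube (coordCube v (memb LT)) x
  cube-C = span-coordCube v LT

  cube-C′ : ∀ x → C′ x ≡ inCube (coordCube v (memb LT′)) x
  cube-C′ = span-coordCube v LT′

  dim-C : dim (coordCube v (memb LT)) ≡ t + 1
  dim-C = begin
    dim (coordCube v (memb LT))  ≡⟨ dim-coordCube v (memb LT) ⟩
    countBelow v (memb LT)       ≡⟨ countBelow-cong v (memb-upTo (t + 1)) ⟩
    countBelow v (below (t + 1)) ≡⟨ countBelow-below v (t + 1) t+1≤v ⟩
    t + 1                        ∎

  dim-C′ : dim (coordCube v (memb LT′)) ≡ t + 1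
  dim-C′ = begin
    dim (coordCube v (memb LT′))      ≡⟨ dim-coordCube v (memb LT′) ⟩
    countBelow v (memb LT′)           ≡⟨ countBelow-cong v (memb-window i (t + 1) m) ⟩
    countBelow v (window i (t + 1) m) ≡⟨ countBelow-window v i (t + 1) m i≤t+1 window≤v ⟩
    i + m                             ≡⟨ m+[n∸m]≡n i≤t+1 ⟩
    t + 1                             ∎

  card-C∩C′ : card (C ∩ C′) ≡ 2 ^ i
  card-C∩C′ = begin
    card (C ∩ C′)
      ≡⟨ countB-cong (λ x → trans (cong₂ _∧_ (cube-C x) (cube-C′ x)) (coordCube-∩ v (memb LT) (memb LT′) x)) (allPoints v) ⟩
    card (inCube (coordCube v shared))       ≡⟨ card-cube (coordCube v shared) ⟩
    2 ^ dim (coordCube v shared)             ≡⟨ cong (2 ^_) (dim-coordCube v shared) ⟩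
    2 ^ countBelow v shared                  ≡⟨ cong (2 ^_) (countBelow-cong v shared-below) ⟩
    2 ^ countBelow v (below i)               ≡⟨ cong (2 ^_) (countBelow-below v i (≤-trans i≤t+1 t+1≤v)) ⟩
    2 ^ i                                    ∎
    where
    shared : ℕ → Bool
    shared k = memb LT k ∧ memb LT′ k
    shared-below : ∀ k → shared k ≡ below i k
    shared-below k = trans (cong₂ _∧_ (memb-upTo (t + 1) k) (memb-window i (t + 1) m k))
                           (window-∩-below i (t + 1) m k i≤t+1)

  card-C : card C ≡ 2 ^ (t + 1)
  card-C = trans (countB-cong cube-C (allPoints v)) (trans (card-cube (coordCube v (memb LT))) (cong (2 ^_) dim-C))

  card-C′ : card C′ ≡ 2 ^ (t + 1)
  card-C′ = trans (countB-cong cube-C′ (allPoints v)) (trans (card-cube (coordCube v (memb LT′))) (cong (2 ^_) dim-C′))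

  balanced-C : (f : Pattern v) → numFixed f ≤ t → Balanced (C ∩ inCube f)
  balanced-C f f≤t = subcube-balanced C (coordCube v (memb LT)) cube-C f
    (subst (numFixed f <_) (sym dim-C) (≤-<-trans f≤t (m<m+n t z<s)))

  balanced-C′ : (f : Pattern v) → numFixed f ≤ t → Balanced (C′ ∩ inCube f)
  balanced-C′ f f≤t = subcube-balanced C′ (coordCube v (memb LT′)) cube-C′ f
    (subst (numFixed f <_) (sym dim-C′) (≤-<-trans f≤t (m<m+n t z<s)))

  unitrade : IsUnitrade v t (C △ C′)
  unitrade f f≡t = symDiff-even C C′ (inCube f) (balanced-C f (≤-reflexive f≡t)) (balanced-C′ f (≤-reflexive f≡t))

  card-symDiff : card (C △ C′) ≡ 2 ^ (t + 2) ∸ 2 ^ (i + 1)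
  card-symDiff = ∸-from-+ (begin
    card (C △ C′) + 2 ^ (i + 1)
      ≡⟨ cong₂ _+_ (card-∩-whole (C △ C′)) (trans (cong₂ _+_ common common) (sym (pow-double i))) ⟨
    card ((C △ C′) ∩ whole v) + (card ((C ∩ C′) ∩ whole v) + card ((C ∩ C′) ∩ whole v))
      ≡⟨ symDiff-count C C′ (whole v) ⟩
    card (C ∩ whole v) + card (C′ ∩ whole v)
      ≡⟨ cong₂ _+_ (trans (card-∩-whole C) card-C) (trans (card-∩-whole C′) card-C′) ⟩
    2 ^ (t + 1) + 2 ^ (t + 1)
      ≡⟨ pow-double (t + 1) ⟨
    2 ^ (t + 1 + 1)
      ≡⟨ cong (2 ^_) (+-assoc t 1 1) ⟩
    2 ^ (t + 2) ∎)
    where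
    common : card ((C ∩ C′) ∩ whole v) ≡ 2 ^ i
    common = trans (card-∩-whole (C ∩ C′)) card-C∩C′

  T₀ T₁ : Family v
  T₀ = parityPart C C′
  T₁ = parityPart C′ C

  equal-counts : (j : ℕ) → j ≤ t → (s : Point v) → size s ≡ j →
                 card (containing T₀ s) ≡ card (containing T₁ s)
  equal-counts j j≤t s |s|≡j = begin
    card (containing T₀ s)         ≡⟨ card-containing T₀ s ⟩
    card (T₀ ∩ inCube (supersetCube s))
      ≡⟨ parityParts-balanced C C′ (inCube (supersetCube s))
           (balanced-C (supersetCube s) fixed≤t) (balanced-C′ (supersetCube s) fixed≤t) ⟩
    card (T₁ ∩ inCube (supersetCube s))  ≡⟨ card-containing T₁ s ⟨
    card (containing T₁ s)         ∎
    where
    fixed≤t : numFixed (supersetCube s) ≤ t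
    fixed≤t = subst (_≤ t) (sym (trans (numFixed-supersetCube s) |s|≡j)) j≤t

  trade : IsTrade v t T₀ T₁
  trade = parityPart-disjoint C C′ , equal-counts

  -- Each side of the trade has half of the points of C △ C′.
  volume : card T₀ ≡ 2 ^ (t + 1) ∸ 2 ^ i
  volume = ∸-from-+ (begin
    card T₀ + 2 ^ i
      ≡⟨ cong₂ _+_ (card-∩-whole T₀) common ⟨
    card (T₀ ∩ whole v) + (parityCount ((C ∩ C′) ∩ whole v) false + parityCount ((C ∩ C′) ∩ whole v) true)
      ≡⟨ parityPart-count C C′ (whole v) ⟩
    parityCount (C ∩ whole v) true + parityCount (C′ ∩ whole v) false
      ≡⟨ cong₂ _+_ (subcube-even C (coordCube v (memb LT)) cube-C t dim-C) odd-C′ ⟩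
    2 ^ t + 2 ^ t
      ≡⟨ pow-double t ⟨
    2 ^ (t + 1) ∎)
    where
    common : parityCount ((C ∩ C′) ∩ whole v) false + parityCount ((C ∩ C′) ∩ whole v) true ≡ 2 ^ i
    common = trans (parity-split ((C ∩ C′) ∩ whole v)) (trans (card-∩-whole (C ∩ C′)) card-C∩C′)
    odd-C′ : parityCount (C′ ∩ whole v) false ≡ 2 ^ t
    odd-C′ = trans (Balanced-cong (λ x → cong (C′ x ∧_) (inCube-fullCube x))
                                  (balanced-C′ (fullCube v) (subst (_≤ t) (sym (numFixed-fullCube v)) z≤n)))
                   (subcube-even C′ (coordCube v (memb LT′)) cube-C′ t dim-C′)

proposition2 : (t i v : ℕ) → 0 < t → i < t → 2 * t + 2 ∸ i ≤ v →
    IsUnitrade v t (span (map (singleton v) (upTo (t + 1))) △ span (map (singleton v) (upTo i ++ map (λ k → t + 1 + k) (upTo (t + 1 ∸ i)))))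
    × card (span (map (singleton v) (upTo (t + 1))) △ span (map (singleton v) (upTo i ++ map (λ k → t + 1 + k) (upTo (t + 1 ∸ i))))) ≡ 2 ^ (t + 2) ∸ 2 ^ (i + 1)
    × Σ (Family v) (λ T0 → Σ (Family v) (λ T1 →
    IsTrade v t T0 T1
    × ((x : Point v) → (T0 x ∨ T1 x) ≡ (span (map (singleton v) (upTo (t + 1))) △ span (map (singleton v) (upTo i ++ map (λ k → t + 1 + k) (upTo (t + 1 ∸ i))))) x)
    × card T0 ≡ 2 ^ (t + 1) ∸ 2 ^ i))
proposition2 t i v _ i<t v-large =
  unitrade , card-symDiff , T₀ , T₁ , trade , parityPart-union C C′ , volume
  where open TwoCubes t i v i<t v-large
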